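{- Maehara interpolation in the cut-free sequent calculus $\mathbf{K}$ is not complete: there exist a $\mathbf{K}$-provable implication $A\to B$ and an interpolant $C$ of it such that no cut-free $\mathbf{K}$ proof $\pi$ of the split sequent $A;\Rightarrow;B$ has $\mathcal{M}(\pi)$ equivalent to $C$ in the modal logic $\mathsf{K}$.
   Context: Modal formulas are built from atoms and $\bot$ using $\wedge,\vee,\neg,\Box$; $A\to B$ abbreviates $\neg A\vee B$; $\top$ abbreviates $\bot\to\bot$; $V(A)$ is the set of atoms of $A$. For a multiset $\Gamma$, $\Box\Gamma=\{\Box A\mid A\in\Gamma\}$. The sequent calculus $\mathbf{K}$ consists of classical propositional $\mathbf{LK}$ (axioms $p\Rightarrow p$ for atoms $p$, axioms $\Box A\Rightarrow\Box A$, axiom $\bot\Rightarrow$, rules weakening, contraction, $(L\wedge_1),(L\wedge_2),(R\wedge),(R\vee_1),(R\vee_2),(L\vee),(L\neg),(R\neg)$, cut, in standard Gentzen G1 form) plus the rule $(K)$: from $\Gamma\Rightarrow A$ infer $\Box\Gamma\Rightarrow\Box A$. An interpolant of a $\mathbf{K}$-provable $A\to B$ is a formula $C$ with $V(C)\subseteq V(A)\cap V(B)$ such that $A\to C$ and $C\to B$ are $\mathbf{K}$-provable. A split sequent $\Gamma_1;\Gamma_2\Rightarrow\Delta_1;\Delta_2$ is the sequent $\Gamma_1,\Gamma_2\Rightarrow\Delta_1,\Delta_2$ with formulas divided into a left side ($\Gamma_1,\Delta_1$) and a right side ($\Gamma_2,\Delta_2$); in a proof of a split sequent every sequent is split, context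 formulas keep their side, auxiliary formulas lie on the side of the main formula, and in $(K)$ each $\Box D$ in the conclusion lies on the side where $D$ lies in the premise. The Maehara interpolant $\mathcal{M}(\pi)$: for axioms with formula $X$ an atom or boxed formula, $X;\Rightarrow X;$ gives $\bot$, $;X\Rightarrow;X$ gives $\top$, $X;\Rightarrow;X$ gives $X$, $;X\Rightarrow X;$ gives $\neg X$; $\bot;\Rightarrow;$ gives $\bot$ and $;\bot\Rightarrow;$ gives $\top$; propositional unary rules keep the premise's interpolant; a binary rule with premise proofs $\pi_1,\pi_2$ gives $\mathcal{M}(\pi_1)\vee\mathcal{M}(\pi_2)$ if its main formula is on the left side and $\mathcal{M}(\pi_1)\wedge\mathcal{M}(\pi_2)$ if on the right side; for $(K)$ with premise interpolant $C$: from $\Gamma_1;\Gamma_2\Rightarrow;A$ to $\Box\Gamma_1;\Box\Gamma_2\Rightarrow;\Box A$ gives $\Box C$, and from $\Gamma_1;\Gamma_2\Rightarrow A;$ to $\Box\Gamma_1;\Box\Gamma_2\Rightarrow\Box A;$ gives $\neg\Box\neg C$. -}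

module Defs where

open import Data.Nat using (ℕ)
open import Data.List using (List; []; _∷_; map)
open import Data.Product using (_×_)
open import Data.List.Relation.Binary.Permutation.Propositional using (_↭_)

infixr 6 _∧_
infixr 5 _∨_

data Fm : Set where
  atom : ℕ → Fm
  ⊥'   : Fm
  _∧_  : Fm → Fm → Fm
  _∨_  : Fm → Fm → Fm
  ¬'   : Fm → Fm
  □    : Fm → Fm

_⇒'_ : Fm → Fm → Fm
A ⇒' B = ¬' A ∨ B

⊤' : Fm
⊤' = ⊥' ⇒' ⊥'

data Occ (p : ℕ) : Fm → Set where
  here  : Occ p (atom p)
  ∧ˡ    : ∀ {A B} → Occ p A → Occ p (A ∧ B)
  ∧ʳ    : ∀ {A B} → Occ p B → Occ p (A ∧ B)
  ∨ˡ    : ∀ {A B} → Occ p A → Occ p (A ∨ B)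
  ∨ʳ    : ∀ {A B} → Occ p B → Occ p (A ∨ B)
  ¬o    : ∀ {A} → Occ p A → Occ p (¬' A)
  □o    : ∀ {A} → Occ p A → Occ p (□ A)

-- Sequents Γ ⇒ Δ are multisets, represented by lists with exchange
-- (permutation) rules. Principal formulas are at the head of the list.

data K⊢ : List Fm → List Fm → Set where
  ax-atom : ∀ p → K⊢ (atom p ∷ []) (atom p ∷ [])
  ax-box  : ∀ A → K⊢ (□ A ∷ []) (□ A ∷ [])
  ax-⊥    : K⊢ (⊥' ∷ []) []
  exL     : ∀ {Γ Γ' Δ} → Γ ↭ Γ' → K⊢ Γ Δ → K⊢ Γ' Δ
  exR     : ∀ {Γ Δ Δ'} → Δ ↭ Δ' → K⊢ Γ Δ → K⊢ Γ Δ'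
  wL      : ∀ {Γ Δ} A → K⊢ Γ Δ → K⊢ (A ∷ Γ) Δ
  wR      : ∀ {Γ Δ} A → K⊢ Γ Δ → K⊢ Γ (A ∷ Δ)
  cL      : ∀ {Γ Δ A} → K⊢ (A ∷ A ∷ Γ) Δ → K⊢ (A ∷ Γ) Δ
  cR      : ∀ {Γ Δ A} → K⊢ Γ (A ∷ A ∷ Δ) → K⊢ Γ (A ∷ Δ)
  L∧₁     : ∀ {Γ Δ A} B → K⊢ (A ∷ Γ) Δ → K⊢ ((A ∧ B) ∷ Γ) Δ
  L∧₂     : ∀ {Γ Δ B} A → K⊢ (B ∷ Γ) Δ → K⊢ ((A ∧ B) ∷ Γ) Δ
  R∧      : ∀ {Γ Δ A B} → K⊢ Γ (A ∷ Δ) → K⊢ Γ (B ∷ Δ) → K⊢ Γ ((A ∧ B) ∷ Δ)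
  R∨₁     : ∀ {Γ Δ A} B → K⊢ Γ (A ∷ Δ) → K⊢ Γ ((A ∨ B) ∷ Δ)
  R∨₂     : ∀ {Γ Δ B} A → K⊢ Γ (B ∷ Δ) → K⊢ Γ ((A ∨ B) ∷ Δ)
  L∨      : ∀ {Γ Δ A B} → K⊢ (A ∷ Γ) Δ → K⊢ (B ∷ Γ) Δ → K⊢ ((A ∨ B) ∷ Γ) Δ
  L¬      : ∀ {Γ Δ A} → K⊢ Γ (A ∷ Δ) → K⊢ (¬' A ∷ Γ) Δ
  R¬      : ∀ {Γ Δ A} → K⊢ (A ∷ Γ) Δ → K⊢ Γ (¬' A ∷ Δ)
  cut     : ∀ {Γ Δ Γ' Δ' D} → K⊢ Γ (D ∷ Δ) → K⊢ (D ∷ Γ') Δ'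
            → K⊢ (Γ Data.List.++ Γ') (Δ Data.List.++ Δ')
  K-rule  : ∀ {Γ A} → K⊢ Γ (A ∷ []) → K⊢ (map □ Γ) (□ A ∷ [])

Prov : Fm → Set
Prov A = K⊢ [] (A ∷ [])

EquivK : Fm → Fm → Set
EquivK A B = Prov (A ⇒' B) × Prov (B ⇒' A)

IsInterpolant : Fm → Fm → Fm → Set
IsInterpolant A B C =
  (∀ p → Occ p C → Occ p A × Occ p B) × Prov (A ⇒' C) × Prov (C ⇒' B)

-- Cut-free split proofs of split sequents  Γ₁ ; Γ₂ ⇒ Δ₁ ; Δ₂
-- (left side: Γ₁, Δ₁ ; right side: Γ₂, Δ₂).
-- Each rule exists in a left-side (…ˡ) and a right-side (…ʳ) version,
-- according to the side of its main formula; context keeps its side.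

data AxFm : Fm → Set where
  atomAx : ∀ p → AxFm (atom p)
  boxAx  : ∀ A → AxFm (□ A)

data SPf : List Fm → List Fm → List Fm → List Fm → Set where
  axLL : ∀ {X} → AxFm X → SPf (X ∷ []) [] (X ∷ []) []
  axRR : ∀ {X} → AxFm X → SPf [] (X ∷ []) [] (X ∷ [])
  axLR : ∀ {X} → AxFm X → SPf (X ∷ []) [] [] (X ∷ [])
  axRL : ∀ {X} → AxFm X → SPf [] (X ∷ []) (X ∷ []) []
  ax⊥ˡ : SPf (⊥' ∷ []) [] [] []
  ax⊥ʳ : SPf [] (⊥' ∷ []) [] []
  ex   : ∀ {Γ₁ Γ₂ Δ₁ Δ₂ Γ₁' Γ₂' Δ₁' Δ₂'} →
         Γ₁ ↭ Γ₁' → Γ₂ ↭ Γ₂' → Δ₁ ↭ Δ₁' → Δ₂ ↭ Δ₂' →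
         SPf Γ₁ Γ₂ Δ₁ Δ₂ → SPf Γ₁' Γ₂' Δ₁' Δ₂'
  wLˡ  : ∀ {Γ₁ Γ₂ Δ₁ Δ₂} A → SPf Γ₁ Γ₂ Δ₁ Δ₂ → SPf (A ∷ Γ₁) Γ₂ Δ₁ Δ₂
  wLʳ  : ∀ {Γ₁ Γ₂ Δ₁ Δ₂} A → SPf Γ₁ Γ₂ Δ₁ Δ₂ → SPf Γ₁ (A ∷ Γ₂) Δ₁ Δ₂
  wRˡ  : ∀ {Γ₁ Γ₂ Δ₁ Δ₂} A → SPf Γ₁ Γ₂ Δ₁ Δ₂ → SPf Γ₁ Γ₂ (A ∷ Δ₁) Δ₂
  wRʳ  : ∀ {Γ₁ Γ₂ Δ₁ Δ₂} A → SPf Γ₁ Γ₂ Δ₁ Δ₂ → SPf Γ₁ Γ₂ Δ₁ (A ∷ Δ₂)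
  cLˡ  : ∀ {Γ₁ Γ₂ Δ₁ Δ₂ A} → SPf (A ∷ A ∷ Γ₁) Γ₂ Δ₁ Δ₂ → SPf (A ∷ Γ₁) Γ₂ Δ₁ Δ₂
  cLʳ  : ∀ {Γ₁ Γ₂ Δ₁ Δ₂ A} → SPf Γ₁ (A ∷ A ∷ Γ₂) Δ₁ Δ₂ → SPf Γ₁ (A ∷ Γ₂) Δ₁ Δ₂
  cRˡ  : ∀ {Γ₁ Γ₂ Δ₁ Δ₂ A} → SPf Γ₁ Γ₂ (A ∷ A ∷ Δ₁) Δ₂ → SPf Γ₁ Γ₂ (A ∷ Δ₁) Δ₂
  cRʳ  : ∀ {Γ₁ Γ₂ Δ₁ Δ₂ A} → SPf Γ₁ Γ₂ Δ₁ (A ∷ A ∷ Δ₂) → SPf Γ₁ Γ₂ Δ₁ (A ∷ Δ₂)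
  L∧₁ˡ : ∀ {Γ₁ Γ₂ Δ₁ Δ₂ A} B → SPf (A ∷ Γ₁) Γ₂ Δ₁ Δ₂ → SPf ((A ∧ B) ∷ Γ₁) Γ₂ Δ₁ Δ₂
  L∧₁ʳ : ∀ {Γ₁ Γ₂ Δ₁ Δ₂ A} B → SPf Γ₁ (A ∷ Γ₂) Δ₁ Δ₂ → SPf Γ₁ ((A ∧ B) ∷ Γ₂) Δ₁ Δ₂
  L∧₂ˡ : ∀ {Γ₁ Γ₂ Δ₁ Δ₂ B} A → SPf (B ∷ Γ₁) Γ₂ Δ₁ Δ₂ → SPf ((A ∧ B) ∷ Γ₁) Γ₂ Δ₁ Δ₂
  L∧₂ʳ : ∀ {Γ₁ Γ₂ Δ₁ Δ₂ B} A → SPf Γ₁ (B ∷ Γ₂) Δ₁ Δ₂ → SPf Γ₁ ((A ∧ B) ∷ Γ₂) Δ₁ Δ₂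
  R∧ˡ  : ∀ {Γ₁ Γ₂ Δ₁ Δ₂ A B} → SPf Γ₁ Γ₂ (A ∷ Δ₁) Δ₂ → SPf Γ₁ Γ₂ (B ∷ Δ₁) Δ₂
         → SPf Γ₁ Γ₂ ((A ∧ B) ∷ Δ₁) Δ₂
  R∧ʳ  : ∀ {Γ₁ Γ₂ Δ₁ Δ₂ A B} → SPf Γ₁ Γ₂ Δ₁ (A ∷ Δ₂) → SPf Γ₁ Γ₂ Δ₁ (B ∷ Δ₂)
         → SPf Γ₁ Γ₂ Δ₁ ((A ∧ B) ∷ Δ₂)
  R∨₁ˡ : ∀ {Γ₁ Γ₂ Δ₁ Δ₂ A} B → SPf Γ₁ Γ₂ (A ∷ Δ₁) Δ₂ → SPf Γ₁ Γ₂ ((A ∨ B) ∷ Δ₁) Δ₂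
  R∨₁ʳ : ∀ {Γ₁ Γ₂ Δ₁ Δ₂ A} B → SPf Γ₁ Γ₂ Δ₁ (A ∷ Δ₂) → SPf Γ₁ Γ₂ Δ₁ ((A ∨ B) ∷ Δ₂)
  R∨₂ˡ : ∀ {Γ₁ Γ₂ Δ₁ Δ₂ B} A → SPf Γ₁ Γ₂ (B ∷ Δ₁) Δ₂ → SPf Γ₁ Γ₂ ((A ∨ B) ∷ Δ₁) Δ₂
  R∨₂ʳ : ∀ {Γ₁ Γ₂ Δ₁ Δ₂ B} A → SPf Γ₁ Γ₂ Δ₁ (B ∷ Δ₂) → SPf Γ₁ Γ₂ Δ₁ ((A ∨ B) ∷ Δ₂)
  L∨ˡ  : ∀ {Γ₁ Γ₂ Δ₁ Δ₂ A B} → SPf (A ∷ Γ₁) Γ₂ Δ₁ Δ₂ → SPf (B ∷ Γ₁) Γ₂ Δ₁ Δ₂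
         → SPf ((A ∨ B) ∷ Γ₁) Γ₂ Δ₁ Δ₂
  L∨ʳ  : ∀ {Γ₁ Γ₂ Δ₁ Δ₂ A B} → SPf Γ₁ (A ∷ Γ₂) Δ₁ Δ₂ → SPf Γ₁ (B ∷ Γ₂) Δ₁ Δ₂
         → SPf Γ₁ ((A ∨ B) ∷ Γ₂) Δ₁ Δ₂
  L¬ˡ  : ∀ {Γ₁ Γ₂ Δ₁ Δ₂ A} → SPf Γ₁ Γ₂ (A ∷ Δ₁) Δ₂ → SPf (¬' A ∷ Γ₁) Γ₂ Δ₁ Δ₂
  L¬ʳ  : ∀ {Γ₁ Γ₂ Δ₁ Δ₂ A} → SPf Γ₁ Γ₂ Δ₁ (A ∷ Δ₂) → SPf Γ₁ (¬' A ∷ Γ₂) Δ₁ Δ₂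
  R¬ˡ  : ∀ {Γ₁ Γ₂ Δ₁ Δ₂ A} → SPf (A ∷ Γ₁) Γ₂ Δ₁ Δ₂ → SPf Γ₁ Γ₂ (¬' A ∷ Δ₁) Δ₂
  R¬ʳ  : ∀ {Γ₁ Γ₂ Δ₁ Δ₂ A} → SPf Γ₁ (A ∷ Γ₂) Δ₁ Δ₂ → SPf Γ₁ Γ₂ Δ₁ (¬' A ∷ Δ₂)
  Kˡ   : ∀ {Γ₁ Γ₂ A} → SPf Γ₁ Γ₂ (A ∷ []) [] → SPf (map □ Γ₁) (map □ Γ₂) (□ A ∷ []) []
  Kʳ   : ∀ {Γ₁ Γ₂ A} → SPf Γ₁ Γ₂ [] (A ∷ []) → SPf (map □ Γ₁) (map □ Γ₂) [] (□ A ∷ [])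

M : ∀ {Γ₁ Γ₂ Δ₁ Δ₂} → SPf Γ₁ Γ₂ Δ₁ Δ₂ → Fm
M (axLL {X} _) = ⊥'
M (axRR {X} _) = ⊤'
M (axLR {X} _) = X
M (axRL {X} _) = ¬' X
M ax⊥ˡ = ⊥'
M ax⊥ʳ = ⊤'
M (ex _ _ _ _ π) = M π
M (wLˡ _ π) = M π
M (wLʳ _ π) = M π
M (wRˡ _ π) = M π
M (wRʳ _ π) = M π
M (cLˡ π) = M π
M (cLʳ π) = M π
M (cRˡ π) = M π
M (cRʳ π) = M π
M (L∧₁ˡ _ π) = M π
M (L∧₁ʳ _ π) = M π
M (L∧₂ˡ _ π) = M π
M (L∧₂ʳ _ π) = M π
M (R∧ˡ π₁ π₂) = M π₁ ∨ M π₂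
M (R∧ʳ π₁ π₂) = M π₁ ∧ M π₂
M (R∨₁ˡ _ π) = M π
M (R∨₁ʳ _ π) = M π
M (R∨₂ˡ _ π) = M π
M (R∨₂ʳ _ π) = M π
M (L∨ˡ π₁ π₂) = M π₁ ∨ M π₂
M (L∨ʳ π₁ π₂) = M π₁ ∧ M π₂
M (L¬ˡ π) = M π
M (L¬ʳ π) = M π
M (R¬ˡ π) = M π
M (R¬ʳ π) = M π
M (Kˡ π) = ¬' (□ (¬' (M π)))
M (Kʳ π) = □ (M π)

-- Take A = ⊥, B = ⊤ and C = □⊥. A cut-free split proof of ⊥ ; ⇒ ; ⊤ only
-- contains subformulas of ⊥ and ⊤, which have neither atoms nor boxes, so its
-- Maehara interpolant has neither either. Such a formula takes the same value at
-- every world of every Kripke model, whereas □⊥ is false at a world with a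
-- successor and true at a dead end. Soundness of K for the two-world model
-- root → leaf therefore separates M(π) from □⊥.
module Submission where

open import Defs
open import Data.Bool using (Bool; true; false; T; not) renaming (_∧_ to _&&_; _∨_ to _||_)
open import Data.Bool.Properties using (T-∧; T-∨)
open import Data.Empty using (⊥-elim)
open import Data.List using (List; []; _∷_)
open import Data.List.Relation.Binary.Permutation.Propositional using (↭-sym)
open import Data.List.Relation.Binary.Permutation.Propositional.Properties
  using (All-resp-↭; Any-resp-↭)
open import Data.List.Relation.Unary.All using (All; []; _∷_)
import Data.List.Relation.Unary.All.Properties as All
open import Data.List.Relation.Unary.Any using (Any; here; there)
import Data.List.Relation.Unary.Any.Properties as Any
open import Data.Nat using (ℕ)
open import Data.Product using (Σ; _×_; _,_; proj₁; proj₂)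
open import Data.Sum using (_⊎_; inj₁; inj₂; [_,_]′)
open import Data.Unit using (tt)
open import Function.Base using (case_of_)
open import Function.Bundles using (Equivalence)
open import Relation.Binary.PropositionalEquality
  using (_≡_; refl; sym; cong; cong₂; module ≡-Reasoning)
open import Relation.Nullary using (¬_)

open Equivalence using (to; from)

T-not⇒¬T : ∀ b → T (not b) → ¬ T b
T-not⇒¬T false _ ()

T-not⊎T : ∀ b → T (not b) ⊎ T b
T-not⊎T false = inj₁ tt
T-not⊎T true  = inj₂ tt

T-⇒-elim : ∀ {a b} → T (not a || b) → T a → T b
T-⇒-elim {a} a⇒b ta = [ (λ t → ⊥-elim (T-not⇒¬T a t ta)) , (λ tb → tb) ]′ (to T-∨ a⇒b)

T-⇔⇒≡ : ∀ {a b} → (T a → T b) → (T b → T a) → a ≡ b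
T-⇔⇒≡ {false} {false} _   _   = refl
T-⇔⇒≡ {false} {true}  _   b⇒a = ⊥-elim (b⇒a tt)
T-⇔⇒≡ {true}  {false} a⇒b _   = ⊥-elim (a⇒b tt)
T-⇔⇒≡ {true}  {true}  _   _   = refl

infixr 6 _∧_
infixr 5 _∨_

data Ground : Fm → Set where
  ⊥'   : Ground ⊥'
  _∧_ : ∀ {A B} → Ground A → Ground B → Ground (A ∧ B)
  _∨_ : ∀ {A B} → Ground A → Ground B → Ground (A ∨ B)
  ¬'   : ∀ {A} → Ground A → Ground (¬' A)

⊤'-Ground : Ground ⊤'
⊤'-Ground = ¬' ⊥' ∨ ⊥'

¬AxFm-Ground : ∀ {X} → AxFm X → ¬ Ground X
¬AxFm-Ground (atomAx p) ()
¬AxFm-Ground (boxAx A) ()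

-- This is where cut-freeness is used: every formula of a split proof is a
-- subformula of its end sequent.
M-Ground : ∀ {Γ₁ Γ₂ Δ₁ Δ₂} (π : SPf Γ₁ Γ₂ Δ₁ Δ₂) →
           All Ground Γ₁ → All Ground Γ₂ → All Ground Δ₁ → All Ground Δ₂ →
           Ground (M π)
M-Ground (axLL x) (g ∷ []) _ _ _ = ⊥-elim (¬AxFm-Ground x g)
M-Ground (axRR x) _ (g ∷ []) _ _ = ⊥-elim (¬AxFm-Ground x g)
M-Ground (axLR x) (g ∷ []) _ _ _ = ⊥-elim (¬AxFm-Ground x g)
M-Ground (axRL x) _ (g ∷ []) _ _ = ⊥-elim (¬AxFm-Ground x g)
M-Ground ax⊥ˡ _ _ _ _ = ⊥'
M-Ground ax⊥ʳ _ _ _ _ = ⊤'-Ground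
M-Ground (ex p q r s π) a b c d =
  M-Ground π (All-resp-↭ (↭-sym p) a) (All-resp-↭ (↭-sym q) b)
             (All-resp-↭ (↭-sym r) c) (All-resp-↭ (↭-sym s) d)
M-Ground (wLˡ _ π) (_ ∷ a) b c d = M-Ground π a b c d
M-Ground (wLʳ _ π) a (_ ∷ b) c d = M-Ground π a b c d
M-Ground (wRˡ _ π) a b (_ ∷ c) d = M-Ground π a b c d
M-Ground (wRʳ _ π) a b c (_ ∷ d) = M-Ground π a b c d
M-Ground (cLˡ π) (g ∷ a) b c d = M-Ground π (g ∷ g ∷ a) b c d
M-Ground (cLʳ π) a (g ∷ b) c d = M-Ground π a (g ∷ g ∷ b) c d
M-Ground (cRˡ π) a b (g ∷ c) d = M-Ground π a b (g ∷ g ∷ c) d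
M-Ground (cRʳ π) a b c (g ∷ d) = M-Ground π a b c (g ∷ g ∷ d)
M-Ground (L∧₁ˡ _ π) ((x ∧ _) ∷ a) b c d = M-Ground π (x ∷ a) b c d
M-Ground (L∧₁ʳ _ π) a ((x ∧ _) ∷ b) c d = M-Ground π a (x ∷ b) c d
M-Ground (L∧₂ˡ _ π) ((_ ∧ y) ∷ a) b c d = M-Ground π (y ∷ a) b c d
M-Ground (L∧₂ʳ _ π) a ((_ ∧ y) ∷ b) c d = M-Ground π a (y ∷ b) c d
M-Ground (R∧ˡ π ρ) a b ((x ∧ y) ∷ c) d = M-Ground π a b (x ∷ c) d ∨ M-Ground ρ a b (y ∷ c) d
M-Ground (R∧ʳ π ρ) a b c ((x ∧ y) ∷ d) = M-Ground π a b c (x ∷ d) ∧ M-Ground ρ a b c (y ∷ d)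
M-Ground (R∨₁ˡ _ π) a b ((x ∨ _) ∷ c) d = M-Ground π a b (x ∷ c) d
M-Ground (R∨₁ʳ _ π) a b c ((x ∨ _) ∷ d) = M-Ground π a b c (x ∷ d)
M-Ground (R∨₂ˡ _ π) a b ((_ ∨ y) ∷ c) d = M-Ground π a b (y ∷ c) d
M-Ground (R∨₂ʳ _ π) a b c ((_ ∨ y) ∷ d) = M-Ground π a b c (y ∷ d)
M-Ground (L∨ˡ π ρ) ((x ∨ y) ∷ a) b c d = M-Ground π (x ∷ a) b c d ∨ M-Ground ρ (y ∷ a) b c d
M-Ground (L∨ʳ π ρ) a ((x ∨ y) ∷ b) c d = M-Ground π a (x ∷ b) c d ∧ M-Ground ρ a (y ∷ b) c d
M-Ground (L¬ˡ π) (¬' x ∷ a) b c d = M-Ground π a b (x ∷ c) d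
M-Ground (L¬ʳ π) a (¬' x ∷ b) c d = M-Ground π a b c (x ∷ d)
M-Ground (R¬ˡ π) a b (¬' x ∷ c) d = M-Ground π (x ∷ a) b c d
M-Ground (R¬ʳ π) a b c (¬' x ∷ d) = M-Ground π a (x ∷ b) c d
M-Ground (Kˡ _) _ _ (() ∷ []) _
M-Ground (Kʳ _) _ _ _ (() ∷ [])

data World : Set where
  root leaf : World

module TwoWorldModel (V : ℕ → World → Bool) where

  -- The only accessibility is root → leaf.
  ⟦_⟧ : Fm → World → Bool
  ⟦ atom p ⟧ w    = V p w
  ⟦ ⊥' ⟧ w        = false
  ⟦ A ∧ B ⟧ w     = ⟦ A ⟧ w && ⟦ B ⟧ w
  ⟦ A ∨ B ⟧ w     = ⟦ A ⟧ w || ⟦ B ⟧ w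
  ⟦ ¬' A ⟧ w      = not (⟦ A ⟧ w)
  ⟦ □ A ⟧ root    = ⟦ A ⟧ leaf
  ⟦ □ A ⟧ leaf    = true

  Holds : World → Fm → Set
  Holds w A = T (⟦ A ⟧ w)

  Valid : List Fm → List Fm → Set
  Valid Γ Δ = ∀ w → All (Holds w) Γ → Any (Holds w) Δ

  sound : ∀ {Γ Δ} → K⊢ Γ Δ → Valid Γ Δ
  sound (ax-atom _) w (t ∷ [])  = here t
  sound (ax-box _) w (t ∷ [])   = here t
  sound ax-⊥ w (() ∷ [])
  sound (exL Γ↭Γ' d) w Γ-holds  = sound d w (All-resp-↭ (↭-sym Γ↭Γ') Γ-holds)
  sound (exR Δ↭Δ' d) w Γ-holds  = Any-resp-↭ Δ↭Δ' (sound d w Γ-holds)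
  sound (wL _ d) w (_ ∷ Γ-holds) = sound d w Γ-holds
  sound (wR _ d) w Γ-holds      = there (sound d w Γ-holds)
  sound (cL d) w (t ∷ Γ-holds)  = sound d w (t ∷ t ∷ Γ-holds)
  sound (cR d) w Γ-holds with sound d w Γ-holds
  ... | here t  = here t
  ... | there x = x
  sound (L∧₁ _ d) w (t ∷ Γ-holds) = sound d w (proj₁ (to T-∧ t) ∷ Γ-holds)
  sound (L∧₂ _ d) w (t ∷ Γ-holds) = sound d w (proj₂ (to T-∧ t) ∷ Γ-holds)
  sound (R∧ d e) w Γ-holds with sound d w Γ-holds | sound e w Γ-holds
  ... | here t  | here u  = here (from T-∧ (t , u))
  ... | here _  | there x = there x
  ... | there x | _       = there x
  sound (R∨₁ _ d) w Γ-holds with sound d w Γ-holds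
  ... | here t  = here (from T-∨ (inj₁ t))
  ... | there x = there x
  sound (R∨₂ _ d) w Γ-holds with sound d w Γ-holds
  ... | here t  = here (from T-∨ (inj₂ t))
  ... | there x = there x
  sound (L∨ d e) w (t ∷ Γ-holds) =
    [ (λ u → sound d w (u ∷ Γ-holds)) , (λ u → sound e w (u ∷ Γ-holds)) ]′ (to T-∨ t)
  sound (L¬ {A = A} d) w (t ∷ Γ-holds) with sound d w Γ-holds
  ... | here u  = ⊥-elim (T-not⇒¬T (⟦ A ⟧ w) t u)
  ... | there x = x
  sound (R¬ {A = A} d) w Γ-holds =
    [ here , (λ t → there (sound d w (t ∷ Γ-holds))) ]′ (T-not⊎T (⟦ A ⟧ w))
  sound (cut {Γ = Γ} {Δ = Δ} d e) w ΓΓ'-holds with All.++⁻ Γ ΓΓ'-holds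
  ... | Γ-holds , Γ'-holds with sound d w Γ-holds
  ...   | here t  = Any.++⁺ʳ Δ (sound e w (t ∷ Γ'-holds))
  ...   | there x = Any.++⁺ˡ x
  sound (K-rule d) root □Γ-holds with sound d leaf (All.map⁻ □Γ-holds)
  ... | here t = here t
  sound (K-rule d) leaf _ = here tt

  Prov⇒Holds : ∀ {A} → Prov A → ∀ w → Holds w A
  Prov⇒Holds d w with sound d w []
  ... | here t = t

  EquivK⇒⟦⟧≡ : ∀ {A B} → EquivK A B → ∀ w → ⟦ A ⟧ w ≡ ⟦ B ⟧ w
  EquivK⇒⟦⟧≡ (A⇒B , B⇒A) w =
    T-⇔⇒≡ (T-⇒-elim (Prov⇒Holds A⇒B w)) (T-⇒-elim (Prov⇒Holds B⇒A w))

  ⟦⟧-Ground-world-independent : ∀ {A} → Ground A → ⟦ A ⟧ root ≡ ⟦ A ⟧ leaf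
  ⟦⟧-Ground-world-independent ⊥'         = refl
  ⟦⟧-Ground-world-independent (A ∧ B)    =
    cong₂ _&&_ (⟦⟧-Ground-world-independent A) (⟦⟧-Ground-world-independent B)
  ⟦⟧-Ground-world-independent (A ∨ B)    =
    cong₂ _||_ (⟦⟧-Ground-world-independent A) (⟦⟧-Ground-world-independent B)
  ⟦⟧-Ground-world-independent (¬' A)     = cong not (⟦⟧-Ground-world-independent A)

ex-falso : ∀ X → Prov (⊥' ⇒' X)
ex-falso X = R∨₁ X (R¬ ax-⊥)

⊤'-provable : Prov ⊤'
⊤'-provable = ex-falso ⊥'

⇒⊤'-provable : ∀ X → Prov (X ⇒' ⊤')
⇒⊤'-provable X = R∨₂ (¬' X) ⊤'-provable

□⊥-interpolates-⊥⇒⊤ : IsInterpolant ⊥' ⊤' (□ ⊥')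
□⊥-interpolates-⊥⇒⊤ = (λ { p (□o ()) }) , ex-falso (□ ⊥') , ⇒⊤'-provable (□ ⊥')

Ground-¬EquivK-□⊥ : ∀ {A} → Ground A → ¬ EquivK A (□ ⊥')
Ground-¬EquivK-□⊥ {A} ground A≈□⊥ = case false≡true of λ ()
  where
  open TwoWorldModel (λ _ _ → false)
  open ≡-Reasoning

  false≡true : false ≡ true
  false≡true = begin
    ⟦ □ ⊥' ⟧ root  ≡⟨ sym (EquivK⇒⟦⟧≡ A≈□⊥ root) ⟩
    ⟦ A ⟧ root     ≡⟨ ⟦⟧-Ground-world-independent ground ⟩
    ⟦ A ⟧ leaf     ≡⟨ EquivK⇒⟦⟧≡ A≈□⊥ leaf ⟩
    ⟦ □ ⊥' ⟧ leaf  ∎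

proposition7p1 : Σ Fm (λ A → Σ Fm (λ B → Σ Fm (λ C →
    Prov (A ⇒' B) × IsInterpolant A B C ×
    ((π : SPf (A ∷ []) [] [] (B ∷ [])) → ¬ EquivK (M π) C))))
proposition7p1 = ⊥' , ⊤' , □ ⊥' , ex-falso ⊤' , □⊥-interpolates-⊥⇒⊤ ,
  λ π → Ground-¬EquivK-□⊥ (M-Ground π (⊥' ∷ []) [] [] (⊤'-Ground ∷ []))
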